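{- Let $b\ge 1$ and let $t_1t_2\ldots t_n$ be a sequence of nonnegative integers, and put $t_i'=t_i+1$ for $1\le i\le n$. Then $t_1t_2\ldots t_n$ is a prime siteswap sequence for $b$ balls if and only if $t_1't_2'\ldots t_n'$ is a prime siteswap sequence for $b+1$ balls.
   Context: For an integer $b\ge 1$, the state graph for $b$ balls is the infinite directed graph whose vertices (states) are the infinite $0$-$1$ sequences $\mathbf{c}=\langle c_1,c_2,\ldots\rangle$ containing exactly $b$ entries equal to $1$, with a directed edge $\mathbf{c}\to\mathbf{d}$ if and only if $d_i\ge c_{i+1}$ for all $i\ge 1$. Each edge $\mathbf{c}\to\mathbf{d}$ carries a label (throw height): the label is $0$ if $c_1=0$ (then $\mathbf{d}$ is the shift $\langle c_2,c_3,\ldots\rangle$), and if $c_1=1$ the label is the unique index $i$ with $d_i=1$ and $c_{i+1}=0$. A siteswap sequence for $b$ balls is the sequence of labels $t_1t_2\ldots t_n$ of the edges of a closed walk of length $n$ in the $b$-ball state graph; it is known that the siteswap sequence determines this closed walk. The siteswap sequence is prime if this closed walk is a cycle, i.e. its $n$ states are pairwise distinct. -}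

module Defs where

open import Data.Nat using (ℕ; zero; suc; _+_; _≤_)
open import Data.Bool using (Bool; true; false; if_then_else_)
open import Data.Fin using (Fin; inject₁; fromℕ) renaming (zero to fzero; suc to fsuc)
open import Data.Vec using (Vec; lookup)
open import Data.Product using (Σ; _×_; _,_)
open import Data.Sum using (_⊎_)
open import Relation.Binary.PropositionalEquality using (_≡_)
open import Relation.Nullary using (¬_)

-- A 0-1 sequence c = ⟨c₁, c₂, …⟩ is represented 0-indexed: (c i) is the
-- paper's c_{i+1}; true = 1, false = 0.

countOnes : (ℕ → Bool) → ℕ → ℕ
countOnes c zero = zero
countOnes c (suc N) = countOnes c N + (if c N then 1 else 0)

HasExactlyOnes : ℕ → (ℕ → Bool) → Set
HasExactlyOnes b c = Σ ℕ λ N → ((i : ℕ) → N ≤ i → c i ≡ false) × (countOnes c N ≡ b)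

State : ℕ → Set
State b = Σ (ℕ → Bool) (HasExactlyOnes b)

seq : ∀ {b} → State b → ℕ → Bool
seq (c , _) = c

SameState : ∀ {b} → State b → State b → Set
SameState c d = (i : ℕ) → seq c i ≡ seq d i

Edge : ∀ {b} → State b → State b → Set
Edge c d = (i : ℕ) → seq c (suc i) ≡ true → seq d i ≡ true

-- the label of an edge c → d is t:
--  * t = 0 if c₁ = 0;
--  * if c₁ = 1, t is the (unique) index i ≥ 1 with d_i = 1 and c_{i+1} = 0
--    (0-indexed: t = suc j with d j = true and c (suc j) = false).
HasLabel : ∀ {b} → State b → State b → ℕ → Set
HasLabel c d t =
  (seq c 0 ≡ false × t ≡ 0)
  ⊎ (seq c 0 ≡ true × Σ ℕ λ j → t ≡ suc j × seq d j ≡ true × seq c (suc j) ≡ false)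

LEdge : ∀ {b} → State b → State b → ℕ → Set
LEdge c d t = Edge c d × HasLabel c d t

ClosedWalk : (b : ℕ) → {n : ℕ} → Vec ℕ n → (Fin (suc n) → State b) → Set
ClosedWalk b {n} t s =
  SameState (s (fromℕ n)) (s fzero)
  × ((k : Fin n) → LEdge (s (inject₁ k)) (s (fsuc k)) (lookup t k))

IsSiteswap : (b : ℕ) → {n : ℕ} → Vec ℕ n → Set
IsSiteswap b t = Σ (_ → State _) (ClosedWalk b t)

IsCycle : (b : ℕ) → {n : ℕ} → (Fin (suc n) → State b) → Set
IsCycle b {n} s = (k l : Fin n) → SameState (s (inject₁ k)) (s (inject₁ l)) → k ≡ l

IsPrimeSiteswap : (b : ℕ) → {n : ℕ} → Vec ℕ n → Set
IsPrimeSiteswap b t = Σ (_ → State b) λ s → ClosedWalk b t s × IsCycle b s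

-- Adding 1 to every throw corresponds to the graph embedding c ↦ ⟨1, c₁, c₂, …⟩
-- from b-ball states to (b+1)-ball states, which maps cycles to cycles.
-- Conversely, in a closed walk whose throws are all positive every state
-- starts with 1, so deleting that 1 walks back down; the only obstacle is a
-- throw of height j+2 from a state ⟨1, 0, …⟩, which would make the tail of the
-- target state properly contain the tail of the tail of the source, although
-- both sets contain b balls.
module Submission where

open import Defs
open import Data.Nat using (ℕ; zero; suc; _+_; _≤_; _<_; _≤′_; ≤′-refl; ≤′-step; z≤n; s≤s)
open import Data.Nat.Properties
open import Data.Bool using (Bool; true; false; if_then_else_)
open import Data.Fin using (Fin; inject₁) renaming (zero to fzero; suc to fsuc)
open import Data.Fin.Relation.Unary.Top using (View; view; ‵fromℕ; ‵inj₁)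
open import Data.Vec using (Vec; []; map; lookup)
open import Data.Vec.Properties using (lookup-map)
open import Data.Product using (_,_; proj₂)
open import Data.Sum using (inj₁; inj₂)
open import Data.Empty using (⊥; ⊥-elim)
open import Relation.Binary.PropositionalEquality
open import Function using (_∘_)
open import Function.Bundles using (_⇔_; mk⇔)

private
  variable
    b m N p : ℕ
    c d : ℕ → Bool

infixr 5 _∷ˢ_
_∷ˢ_ : Bool → (ℕ → Bool) → ℕ → Bool
(x ∷ˢ c) zero = x
(x ∷ˢ c) (suc i) = c i

tailˢ : (ℕ → Bool) → ℕ → Bool
tailˢ c i = c (suc i)

infix 4 _⊆ˢ_
_⊆ˢ_ : (ℕ → Bool) → (ℕ → Bool) → Set
c ⊆ˢ d = ∀ i → c i ≡ true → d i ≡ true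

bit : Bool → ℕ
bit x = if x then 1 else 0

bit-mono : ∀ {x y} → (x ≡ true → y ≡ true) → bit x ≤ bit y
bit-mono {false} _ = z≤n
bit-mono {true} x⇒y rewrite x⇒y refl = ≤-refl

countOnes-tail : ∀ c N → countOnes c (suc N) ≡ bit (c 0) + countOnes (tailˢ c) N
countOnes-tail c zero = sym (+-identityʳ (bit (c 0)))
countOnes-tail c (suc N) = begin
  countOnes c (suc N) + bit (c (suc N))
    ≡⟨ cong (_+ bit (c (suc N))) (countOnes-tail c N) ⟩
  bit (c 0) + countOnes (tailˢ c) N + bit (c (suc N))
    ≡⟨ +-assoc (bit (c 0)) _ _ ⟩
  bit (c 0) + countOnes (tailˢ c) (suc N) ∎
  where open ≡-Reasoning

countOnes-stable : (∀ i → N ≤ i → c i ≡ false) → ∀ {M} → N ≤ M → countOnes c M ≡ countOnes c N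
countOnes-stable {N} {c} bound N≤M = go (≤⇒≤′ N≤M)
  where
  go : ∀ {M} → N ≤′ M → countOnes c M ≡ countOnes c N
  go ≤′-refl = refl
  go (≤′-step {M} N≤′M) rewrite bound M (≤′⇒≤ N≤′M) = trans (+-identityʳ _) (go N≤′M)

countOnes-mono : c ⊆ˢ d → ∀ N → countOnes c N ≤ countOnes d N
countOnes-mono c⊆d zero = z≤n
countOnes-mono c⊆d (suc N) = +-mono-≤ (countOnes-mono c⊆d N) (bit-mono (c⊆d N))

countOnes-strict : c ⊆ˢ d → c p ≡ false → d p ≡ true → p < N → countOnes c N < countOnes d N
countOnes-strict {c} {d} {p} {suc N} c⊆d cp dp p<1+N with m<1+n⇒m<n∨m≡n p<1+N
... | inj₁ p<N = +-mono-<-≤ (countOnes-strict c⊆d cp dp p<N) (bit-mono (c⊆d N))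
... | inj₂ refl rewrite cp | dp = +-mono-≤-< (countOnes-mono c⊆d p) (s≤s z≤n)

⊆ˢ-proper-⊥ : HasExactlyOnes b c → HasExactlyOnes b d → c ⊆ˢ d → c p ≡ false → d p ≡ true → ⊥
⊆ˢ-proper-⊥ {b} {c} {d} {p} (Nc , bound-c , count-c) (Nd , bound-d , count-d) c⊆d cp dp =
  <-irrefl same-count (countOnes-strict c⊆d cp dp (m≤m+n (suc p) _))
  where
  M = suc p + (Nc + Nd)
  same-count : countOnes c M ≡ countOnes d M
  same-count = begin
    countOnes c M  ≡⟨ countOnes-stable bound-c (≤-trans (m≤m+n Nc Nd) (m≤n+m _ (suc p))) ⟩
    countOnes c Nc ≡⟨ trans count-c (sym count-d) ⟩
    countOnes d Nd ≡⟨ countOnes-stable bound-d (≤-trans (m≤n+m Nd Nc) (m≤n+m _ (suc p))) ⟨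
    countOnes d M  ∎
    where open ≡-Reasoning

∷ˢ-ones : ∀ x → HasExactlyOnes b c → HasExactlyOnes (bit x + b) (x ∷ˢ c)
∷ˢ-ones {c = c} x (N , bound , count) =
  suc N , bound′ , trans (countOnes-tail (x ∷ˢ c) N) (cong (bit x +_) count)
  where
  bound′ : ∀ i → suc N ≤ i → (x ∷ˢ c) i ≡ false
  bound′ (suc i) (s≤s N≤i) = bound i N≤i

tailˢ-ones : HasExactlyOnes (bit (c 0) + b) c → HasExactlyOnes b (tailˢ c)
tailˢ-ones {c} {b} (N , bound , count) =
  N , (λ i N≤i → bound (suc i) (m≤n⇒m≤1+n N≤i)) , +-cancelˡ-≡ (bit (c 0)) _ _ bit+count
  where
  bit+count : bit (c 0) + countOnes (tailˢ c) N ≡ bit (c 0) + b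
  bit+count = begin
    bit (c 0) + countOnes (tailˢ c) N ≡⟨ countOnes-tail c N ⟨
    countOnes c (suc N)               ≡⟨ countOnes-stable bound (n≤1+n N) ⟩
    countOnes c N                     ≡⟨ count ⟩
    bit (c 0) + b                     ∎
    where open ≡-Reasoning

tailˢ-ones-true : c 0 ≡ true → HasExactlyOnes (suc b) c → HasExactlyOnes b (tailˢ c)
tailˢ-ones-true {c} {b} c0 = tailˢ-ones ∘ subst (λ x → HasExactlyOnes (bit x + b) c) (sym c0)

tailˢ-ones-false : c 0 ≡ false → HasExactlyOnes b c → HasExactlyOnes b (tailˢ c)
tailˢ-ones-false {c} {b} c0 = tailˢ-ones ∘ subst (λ x → HasExactlyOnes (bit x + b) c) (sym c0)

raise : State b → State (suc b)
raise (c , ones) = true ∷ˢ c , ∷ˢ-ones true ones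

lower : (s : State (suc b)) → seq s 0 ≡ true → State b
lower (c , ones) c0 = tailˢ c , tailˢ-ones-true c0 ones

ground : ∀ b → State b
ground zero = (λ _ → false) , 0 , (λ _ _ → refl) , refl
ground (suc b) = raise (ground b)

raise-LEdge : ∀ {c d : State b} {t} → LEdge c d t → LEdge (raise c) (raise d) (suc t)
raise-LEdge {c = c} {d} {t} (edge , label) = edge′ , label′ label
  where
  edge′ : Edge (raise c) (raise d)
  edge′ zero _ = refl
  edge′ (suc i) = edge i
  label′ : HasLabel c d t → HasLabel (raise c) (raise d) (suc t)
  label′ (inj₁ (c0 , t≡0)) = inj₂ (refl , 0 , cong suc t≡0 , refl , c0)
  label′ (inj₂ (_ , j , t≡1+j , dj , cj)) = inj₂ (refl , suc j , cong suc t≡1+j , dj , cj)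

LEdge-positive-head : ∀ {c d : State b} {t} → LEdge c d (suc t) → seq c 0 ≡ true
LEdge-positive-head (_ , inj₂ (c0 , _)) = c0

lower-LEdge : ∀ {c d : State (suc b)} {t} (c0 : seq c 0 ≡ true) (d0 : seq d 0 ≡ true) →
  LEdge c d (suc t) → LEdge (lower c c0) (lower d d0) t
lower-LEdge {b} {c} {d} {t} c0 d0 (edge , label) = (λ i → edge (suc i)) , label′ label
  where
  label′ : HasLabel c d (suc t) → HasLabel (lower c c0) (lower d d0) t
  label′ (inj₂ (_ , zero , t+1≡1 , _ , c1)) = inj₁ (c1 , suc-injective t+1≡1)
  label′ (inj₂ (_ , suc j , t+1≡2+j , dj , cj)) with seq c 1 in c1
  ... | true = inj₂ (refl , j , suc-injective t+1≡2+j , dj , cj)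
  ... | false = ⊥-elim (⊆ˢ-proper-⊥
    (tailˢ-ones-false c1 (tailˢ-ones-true c0 (proj₂ c))) (tailˢ-ones-true d0 (proj₂ d))
    (λ i → edge (suc i)) cj dj)

raise-prime : ∀ {n} {t : Vec ℕ n} → IsPrimeSiteswap b t → IsPrimeSiteswap (suc b) (map suc t)
raise-prime {t = t} (s , (closed , edges) , cycle) =
  raise ∘ s ,
  ((λ { zero → refl ; (suc i) → closed i }) , raised-edge) ,
  (λ k l same → cycle k l (same ∘ suc))
  where
  raised-edge : ∀ k → LEdge (raise (s (inject₁ k))) (raise (s (fsuc k))) (lookup (map suc t) k)
  raised-edge k =
    subst (LEdge (raise (s (inject₁ k))) (raise (s (fsuc k)))) (sym (lookup-map k suc t))
      (raise-LEdge {c = s (inject₁ k)} {s (fsuc k)} (edges k))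

ClosedWalk-map-suc : ∀ {n} {t : Vec ℕ n} {s} → ClosedWalk b (map suc t) s →
  ∀ k → LEdge (s (inject₁ k)) (s (fsuc k)) (suc (lookup t k))
ClosedWalk-map-suc {t = t} {s} (_ , edges) k =
  subst (LEdge (s (inject₁ k)) (s (fsuc k))) (lookup-map k suc t) (edges k)

ClosedWalk-map-suc-heads : ∀ {t : Vec ℕ (suc m)} {s} → ClosedWalk b (map suc t) s →
  ∀ k → seq (s k) 0 ≡ true
ClosedWalk-map-suc-heads {t = t} {s} walk@(closed , _) k = head (view k)
  where
  source-head : ∀ k → seq (s (inject₁ k)) 0 ≡ true
  source-head k =
    LEdge-positive-head {c = s (inject₁ k)} {s (fsuc k)} (ClosedWalk-map-suc {t = t} {s} walk k)
  head : ∀ {k} → View k → seq (s k) 0 ≡ true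
  head ‵fromℕ = trans (closed 0) (source-head fzero)
  head (‵inj₁ {i = k} _) = source-head k

lower-prime : ∀ {n} {t : Vec ℕ n} → IsPrimeSiteswap (suc b) (map suc t) → IsPrimeSiteswap b t
lower-prime {b} {zero} {[]} _ = (λ _ → ground b) , ((λ _ → refl) , λ ()) , λ ()
lower-prime {b} {suc n} {t} (s , walk@(closed , _) , cycle) =
  lowered , ((closed ∘ suc) , lowered-edge) , lowered-cycle
  where
  head : ∀ k → seq (s k) 0 ≡ true
  head = ClosedWalk-map-suc-heads {t = t} {s} walk
  lowered : Fin (suc (suc n)) → State b
  lowered k = lower (s k) (head k)
  lowered-edge : ∀ k → LEdge (lowered (inject₁ k)) (lowered (fsuc k)) (lookup t k)
  lowered-edge k = lower-LEdge {c = s (inject₁ k)} {s (fsuc k)} (head (inject₁ k)) (head (fsuc k))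
    (ClosedWalk-map-suc {t = t} {s} walk k)
  lowered-cycle : IsCycle b lowered
  lowered-cycle k l same = cycle k l λ
    { zero → trans (head (inject₁ k)) (sym (head (inject₁ l)))
    ; (suc i) → same i
    }

mainTheorem10 : (b : ℕ) → 1 ≤ b → (n : ℕ) → (t : Vec ℕ n) →
    IsPrimeSiteswap b t ⇔ IsPrimeSiteswap (suc b) (map suc t)
mainTheorem10 b _ n t = mk⇔ (raise-prime {t = t}) (lower-prime {t = t})
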